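{- Let $\sigma$ be a signature, $\mathcal F,\mathcal G$ systems of functions over $\sigma$, and $\mathbf X=\mathbf x$ a consistent equation over $\sigma$. If $\mathcal F\sim\mathcal G$, then $\mathcal F_{\mathbf X=\mathbf x}\sim\mathcal G_{\mathbf X=\mathbf x}$.
   Context: A signature $\sigma=(\mathrm{Dom},\mathrm{Ran})$ consists of a nonempty finite set $\mathrm{Dom}$ of variables with nonempty finite ranges $\mathrm{Ran}(X)$; $\mathrm{Ran}(\mathbf X)$ is the product of ranges. A system of functions $\mathcal F$ over $\sigma$ assigns to each $V$ in a set $\mathrm{En}(\mathcal F)\subseteq\mathrm{Dom}$ a set $PA_V^{\mathcal F}\subseteq\mathrm{Dom}\setminus\{V\}$ and a function $\mathcal F_V:\mathrm{Ran}(PA_V^{\mathcal F})\to\mathrm{Ran}(V)$. $\mathrm{Cn}(\mathcal F)$ is the set of $V\in\mathrm{En}(\mathcal F)$ such that $\mathcal F_V$ is constant. An equation $\mathbf X=\mathbf x$ is a conjunction $X_1=x_1\wedge\dots\wedge X_n=x_n$ with $x_i\in\mathrm{Ran}(X_i)$; it is consistent if no variable is assigned two distinct values. $\mathcal F_{\mathbf X=\mathbf x}$ denotes the restriction of $\mathcal F$ to $\mathrm{En}(\mathcal F)\setminus\mathbf X$ (same parent sets and functions for the remaining endogenous variables). For $V\in\mathrm{Dom}$, $\mathcal F_V\sim\mathcal G_V$ means $\mathcal F_V(\mathbf x\mathbf y)=\mathcal G_V(\mathbf x\mathbf z)$ for all $\mathbf x\in\mathrm{Ran}(PA_V^{\mathcal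 F}\cap PA_V^{\mathcal G})$, $\mathbf y\in\mathrm{Ran}(PA_V^{\mathcal F}\setminus PA_V^{\mathcal G})$, $\mathbf z\in\mathrm{Ran}(PA_V^{\mathcal G}\setminus PA_V^{\mathcal F})$ (arguments in the shown arrangement). $\mathcal F\sim\mathcal G$ (equivalence up to dummy arguments) iff $\mathrm{En}(\mathcal F)\setminus\mathrm{Cn}(\mathcal F)=\mathrm{En}(\mathcal G)\setminus\mathrm{Cn}(\mathcal G)$ and $\mathcal F_V\sim\mathcal G_V$ for all $V$ in this set. -}

module Defs where

open import Data.Nat using (ℕ; NonZero)
open import Data.Fin using (Fin)
open import Data.Fin.Subset using (Subset; _∈_; _∉_; _∩_; _∪_; ∁; ⁅_⁆; ⊥)
open import Data.List using (List; foldr)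
open import Data.List.Membership.Propositional using () renaming (_∈_ to _∈ₗ_)
open import Data.Product using (Σ; _×_; proj₁; proj₂)
open import Relation.Binary.PropositionalEquality using (_≡_)
open import Relation.Nullary using (¬_)
open import Function.Bundles using (_⇔_)

record Signature : Set where
  field
    n          : ℕ
    {{n≢0}}    : NonZero n
    rng        : Fin n → ℕ
    rng≢0      : ∀ X → NonZero (rng X)

open Signature public

Dom : Signature → Set
Dom σ = Fin (n σ)

Ran : (σ : Signature) → Dom σ → Set
Ran σ X = Fin (rng σ X)

VarSet : Signature → Set
VarSet σ = Subset (n σ)

Asg : (σ : Signature) → VarSet σ → Set
Asg σ S = (V : Dom σ) → V ∈ S → Ran σ V

-- A system of functions over σ.  PA and F are given for every variable,
-- but only their values at endogenous variables (V ∈ En) are meaningful.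
record System (σ : Signature) : Set where
  field
    En    : VarSet σ
    PA    : Dom σ → VarSet σ
    PA-irrefl : ∀ V → V ∈ En → V ∉ PA V
    F     : (V : Dom σ) → Asg σ (PA V) → Ran σ V

open System public

Const : ∀ {σ} → System σ → Dom σ → Set
Const {σ} 𝓕 V = ∀ (a b : Asg σ (PA 𝓕 V)) → F 𝓕 V a ≡ F 𝓕 V b

InCn : ∀ {σ} → System σ → Dom σ → Set
InCn 𝓕 V = V ∈ En 𝓕 × Const 𝓕 V

InEnNotCn : ∀ {σ} → System σ → Dom σ → Set
InEnNotCn 𝓕 V = V ∈ En 𝓕 × ¬ Const 𝓕 V

-- F_V ~ G_V: an assignment to PA^F_V is a pair (x,y) with x on the
-- intersection and y on PA^F \ PA^G; similarly (x,z) for PA^G.  So the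
-- definition says: F_V a = G_V b whenever a, b agree on PA^F ∩ PA^G.
_∼[_]_ : ∀ {σ} → System σ → Dom σ → System σ → Set
_∼[_]_ {σ} 𝓕 V 𝓖 =
  ∀ (a : Asg σ (PA 𝓕 V)) (b : Asg σ (PA 𝓖 V)) →
  (∀ W (p : W ∈ PA 𝓕 V) (q : W ∈ PA 𝓖 V) → a W p ≡ b W q) →
  F 𝓕 V a ≡ F 𝓖 V b

_∼_ : ∀ {σ} → System σ → System σ → Set
𝓕 ∼ 𝓖 = (∀ V → InEnNotCn 𝓕 V ⇔ InEnNotCn 𝓖 V)
      × (∀ V → InEnNotCn 𝓕 V → 𝓕 ∼[ V ] 𝓖)

Equation : Signature → Set
Equation σ = List (Σ (Dom σ) (Ran σ))

Consistent : ∀ {σ} → Equation σ → Set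
Consistent eq = ∀ {e e'} → e ∈ₗ eq → e' ∈ₗ eq → proj₁ e ≡ proj₁ e' → e ≡ e'

vars : ∀ {σ} → Equation σ → VarSet σ
vars {σ} eq = foldr (λ (e : Σ (Dom σ) (Ran σ)) (S : VarSet σ) → ⁅ proj₁ e ⁆ ∪ S) ⊥ eq

intervene : ∀ {σ} → System σ → Equation σ → System σ
intervene {σ} 𝓕 eq = record
  { En = En 𝓕 ∩ ∁ (vars {σ} eq)
  ; PA = PA 𝓕
  ; PA-irrefl = λ V V∈ → PA-irrefl 𝓕 V (proj₁ (x∈p∩q⁻ (En 𝓕) (∁ (vars {σ} eq)) V∈))
  ; F = F 𝓕
  }
  where open import Data.Fin.Subset.Properties using (x∈p∩q⁻)

module Submission where

-- An intervention X = x changes a system of functions in exactly one way: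
-- the variables X stop being endogenous, while the parent sets and the
-- functions of all remaining endogenous variables are left untouched.
-- Hence
--   * the non-constant endogenous variables of F_{X=x} are those of F
--     that lie outside X  (active-intervene), and
--   * the relation F_V ∼ G_V only mentions parent sets and functions, so
--     it is unaffected by the intervention  (intervene-preserves-∼[]).
-- The theorem follows: the first fact transports the equality of the sets
-- En \ Cn from F, G to F_{X=x}, G_{X=x}, and the second transports the
-- pointwise equivalence of the functions.

open import Defs
open import Data.Product using (_×_; _,_; proj₁)
open import Data.Product.Function.NonDependent.Propositional using (_×-⇔_)
open import Data.Fin.Subset using (_∉_)
open import Data.Fin.Subset.Properties using (x∈p∩q⁻; x∈p∩q⁺; x∈∁p⇒x∉p; x∉p⇒x∈∁p)
open import Function.Bundles using (_⇔_; mk⇔; Equivalence)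
open import Function.Properties.Equivalence using () renaming (refl to ⇔-refl; sym to ⇔-sym; trans to ⇔-trans)

module _ {σ : Signature} where

  active-intervene : (𝓗 : System σ) (eq : Equation σ) (V : Dom σ) →
    InEnNotCn (intervene 𝓗 eq) V ⇔ (InEnNotCn 𝓗 V × V ∉ vars {σ} eq)
  active-intervene 𝓗 eq V = mk⇔ to from
    where
    to : InEnNotCn (intervene 𝓗 eq) V → InEnNotCn 𝓗 V × V ∉ vars {σ} eq
    to (V∈En∖X , nonconst) with x∈p∩q⁻ (En 𝓗) _ V∈En∖X
    ... | V∈En , V∈∁X = (V∈En , nonconst) , x∈∁p⇒x∉p V∈∁X

    from : InEnNotCn 𝓗 V × V ∉ vars {σ} eq → InEnNotCn (intervene 𝓗 eq) V
    from ((V∈En , nonconst) , V∉X) = x∈p∩q⁺ (V∈En , x∉p⇒x∈∁p V∉X) , nonconst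

  intervene-preserves-∼[] : (𝓕 𝓖 : System σ) (eq : Equation σ) (V : Dom σ) →
    𝓕 ∼[ V ] 𝓖 → intervene 𝓕 eq ∼[ V ] intervene 𝓖 eq
  intervene-preserves-∼[] 𝓕 𝓖 eq V 𝓕∼𝓖 = 𝓕∼𝓖

lemma3p2 : (σ : Signature) (𝓕 𝓖 : System σ) (eq : Equation σ) →
    Consistent {σ} eq → 𝓕 ∼ 𝓖 → intervene 𝓕 eq ∼ intervene 𝓖 eq
lemma3p2 σ 𝓕 𝓖 eq _ (same-active , same-functions) = same-active′ , same-functions′
  where
  open Equivalence

  same-active′ : ∀ V → InEnNotCn (intervene 𝓕 eq) V ⇔ InEnNotCn (intervene 𝓖 eq) V
  same-active′ V = ⇔-trans (active-intervene 𝓕 eq V)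
                  (⇔-trans (same-active V ×-⇔ ⇔-refl)
                           (⇔-sym (active-intervene 𝓖 eq V)))

  same-functions′ : ∀ V → InEnNotCn (intervene 𝓕 eq) V → intervene 𝓕 eq ∼[ V ] intervene 𝓖 eq
  same-functions′ V active =
    intervene-preserves-∼[] 𝓕 𝓖 eq V
      (same-functions V (proj₁ (to (active-intervene 𝓕 eq V) active)))
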